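{- Let $s_2$ be a binary string with $|s_2|\ge2$, $s_2\ne00$, and $S=\{00,s_2\}$. The Seeker wins the Renyi-Ulam game with lie restriction $r(S)$ if and only if $s_2\in R_\#$.
   Context: $R_\#$ is the set of binary strings containing no substring $01^k0$ with $k=0$ or $k\ge2$ ($1^k$ denotes $k$ consecutive $1$s); explicitly $R_\#=\{1^a w 1^c: a,c\ge0,\ w \text{ empty or } w=(01)^j0,\ j\ge0\}$. For a set $S$ of nonempty binary strings, $r(S)$ is the set of finite binary strings containing no element of $S$ as a contiguous substring. Renyi-Ulam game with lie restriction $R$: the Obscurer picks $x\in\{1,\dots,n\}$; each turn the Seeker asks whether $x$ lies in a chosen subset and the Obscurer answers yes or no. The lie pattern of a candidate $y$ is the binary string whose $i$-th bit is $1$ iff the $i$-th answer is false for $y$; the Obscurer's answers must keep her number's lie pattern in $R$. The Seeker wins for $n$ if he has an adaptive strategy guaranteeing after finitely many questions that at most one $y\in\{1,\dots,n\}$ has lie pattern in $R$; "the Seeker wins" means he wins for every $n\ge1$. -}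

module Defs where

open import Data.Bool using (Bool; true; false; _≟_; if_then_else_)
open import Data.Nat using (ℕ; _≤_)
open import Data.Fin using (Fin)
open import Data.List using (List; []; _∷_; _++_; replicate; length)
open import Data.List.Relation.Unary.All using (All)
open import Data.Product using (∃₂)
open import Relation.Binary.PropositionalEquality using (_≡_; _≢_)
open import Relation.Nullary using (¬_; does)

-- Binary strings: true = 1, false = 0.
BinStr : Set
BinStr = List Bool

_⊑_ : BinStr → BinStr → Set
s ⊑ w = ∃₂ λ u v → u ++ s ++ v ≡ w

r : List BinStr → BinStr → Set
r S w = All (λ s → ¬ (s ⊑ w)) S

R# : BinStr → Set
R# w = ∀ (k : ℕ) → k ≢ 1 → ¬ ((false ∷ replicate k true ++ false ∷ []) ⊑ w)

-- A game position: the lie pattern so far of each candidate y ∈ {1..n}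
-- (represented by Fin n), patterns written in chronological order.
Position : ℕ → Set
Position n = Fin n → BinStr

AtMostOneAlive : (BinStr → Set) → ∀ {n} → Position n → Set
AtMostOneAlive R {n} p = ∀ (y z : Fin n) → R (p y) → R (p z) → y ≡ z

-- Update after the Seeker asks "is x ∈ Q?" and the Obscurer answers b:
-- the answer is a lie for y iff (y ∈ Q) ≠ b; append that bit.
step : ∀ {n} → Position n → (Fin n → Bool) → Bool → Position n
step p Q b y = p y ++ ((if does (Q y ≟ b) then false else true) ∷ [])

-- The Seeker can force (in finitely many questions, adaptively) a position
-- in which at most one candidate has lie pattern in R.
-- (Answers that would leave no candidate with pattern in R are illegal for
-- the Obscurer, but such positions are already won, so allowing them is harmless.)
data SeekerWinsFrom (R : BinStr → Set) {n : ℕ} : Position n → Set where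
  done : ∀ {p} → AtMostOneAlive R p → SeekerWinsFrom R p
  ask  : ∀ {p} (Q : Fin n → Bool) →
         (∀ (b : Bool) → SeekerWinsFrom R (step p Q b)) → SeekerWinsFrom R p

SeekerWinsFor : (BinStr → Set) → ℕ → Set
SeekerWinsFor R n = SeekerWinsFrom R {n} (λ _ → [])

SeekerWins : (BinStr → Set) → Set
SeekerWins R = ∀ (n : ℕ) → 1 ≤ n → SeekerWinsFor R n

-- Since lie restrictions of the form r S are closed under prefixes, the Seeker wins as soon as,
-- for any two lie patterns u and v, he can force one of them out of r S with questions that
-- either put both candidates on the same side or separate them; he can then eliminate the
-- candidates two at a time.  For s₂ ∈ R#, i.e. s₂ = 1^a or s₂ = 1^a 0 (10)^j 1^c, he appends
-- 1^a to both patterns with trivial questions (a truthful answer gives both a 0, and the next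
-- separating question creates 00), then 0 (10)^j to one of them with separating questions, and
-- finally 1^c, completing s₂.
-- Conversely, if s₂ contains 0 1^k 0 with k ≠ 1, the Obscurer keeps two candidates avoiding both
-- 00 and 0 1^k 0.  Appending 1 is always safe, and she keeps the numbers of 1s after the last 0
-- of the two patterns distinct and different from {0, k}; then for every separating question
-- one of the two ways of appending a single 0 closes neither pattern and keeps this invariant.
module Submission where

open import Defs
open import Data.Bool using (Bool; true; false; not; if_then_else_; _≟_)
open import Data.Bool.Properties using (not-involutive)
open import Data.Fin using (Fin)
open import Data.Fin.Patterns using (0F; 1F)
open import Data.Fin.Properties using (0≢1+n) renaming (_≟_ to _≟ᶠ_)
open import Data.List using ([]; _∷_; _++_; _∷ʳ_; length; replicate; foldl; initLast; _∷ʳ′_)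
open import Data.List.Properties using (++-assoc; ++-identityʳ; ∷ʳ-injective; ∷ʳ-injectiveˡ; ∷ʳ-++; foldl-++; foldl-∷ʳ)
open import Data.List.Membership.Propositional using (_∈_)
open import Data.List.Membership.Propositional.Properties using (∈-allFin)
open import Data.List.Relation.Unary.All as All using ([]; _∷_)
open import Data.List.Relation.Unary.Any using (here; there)
open import Data.List.Relation.Unary.Any.Properties using (singleton⁻)
open import Data.Nat using (ℕ; zero; suc; _+_; _<_; _≤_; z≤n; s≤s)
open import Data.Nat.Properties
  using (suc-injective; 1+n≢n; ≤-reflexive; <⇒≢; <-asym; m<n⇒m<1+n; n≮0; n<1+n; +-suc; +-identityʳ)
  renaming (_≟_ to _≟ⁿ_)
open import Data.Product as Product using (_×_; _,_; ∃; ∃₂; proj₁; proj₂)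
open import Data.Sum as Sum using (_⊎_; inj₁; inj₂)
open import Function using (_∘_)
open import Function.Bundles using (_⇔_; mk⇔)
open import Relation.Binary.PropositionalEquality
open import Relation.Nullary using (¬_; yes; no; does; contradiction)
open import Relation.Nullary.Decidable using (dec-true; dec-false)

open ≡-Reasoning

ones : ℕ → BinStr
ones m = replicate m true

block : ℕ → BinStr
block m = false ∷ ones m ++ false ∷ []

_EndsWith_ : BinStr → BinStr → Set
u EndsWith s = ∃ λ w → w ++ s ≡ u

⊑-∷ : ∀ {s u} x → s ⊑ u → s ⊑ (x ∷ u)
⊑-∷ x (a , b , e) = x ∷ a , b , cong (x ∷_) e

⊑-++ʳ : ∀ {s u} v → s ⊑ u → s ⊑ (u ++ v)
⊑-++ʳ {s} {u} v (a , b , e) = a , b ++ v , (begin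
  a ++ s ++ b ++ v   ≡⟨ cong (a ++_) (++-assoc s b v) ⟨
  a ++ (s ++ b) ++ v ≡⟨ ++-assoc a (s ++ b) v ⟨
  (a ++ s ++ b) ++ v ≡⟨ cong (_++ v) e ⟩
  u ++ v             ∎)

⊑-trans : ∀ {t s u} → t ⊑ s → s ⊑ u → t ⊑ u
⊑-trans {t} {s} {u} (a , b , e) (c , d , e′) = c ++ a , b ++ d , (begin
  (c ++ a) ++ t ++ b ++ d   ≡⟨ ++-assoc c a (t ++ b ++ d) ⟩
  c ++ a ++ t ++ b ++ d     ≡⟨ cong (λ x → c ++ a ++ x) (++-assoc t b d) ⟨
  c ++ a ++ (t ++ b) ++ d   ≡⟨ cong (c ++_) (++-assoc a (t ++ b) d) ⟨
  c ++ (a ++ t ++ b) ++ d   ≡⟨ cong (λ x → c ++ x ++ d) e ⟩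
  c ++ s ++ d               ≡⟨ e′ ⟩
  u                         ∎)

⊑-suffix : ∀ w s → s ⊑ (w ++ s)
⊑-suffix w s = w , [] , cong (w ++_) (++-identityʳ s)

¬∷⊑[] : ∀ {x s} → ¬ (x ∷ s) ⊑ []
¬∷⊑[] ([]    , _ , ())
¬∷⊑[] (_ ∷ _ , _ , ())

⊑-∷ʳ⁻ : ∀ s u {x y} → (s ∷ʳ x) ⊑ (u ∷ʳ y) → (s ∷ʳ x) ⊑ u ⊎ u EndsWith s × x ≡ y
⊑-∷ʳ⁻ s u {x} {y} (a , b , e) with initLast b
... | [] = inj₂ (Product.map₁ (a ,_) (∷ʳ-injective (a ++ s) u (begin
  (a ++ s) ∷ʳ x        ≡⟨ ++-assoc a s (x ∷ []) ⟩
  a ++ s ∷ʳ x          ≡⟨ cong (a ++_) (++-identityʳ (s ∷ʳ x)) ⟨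
  a ++ (s ∷ʳ x) ++ []  ≡⟨ e ⟩
  u ∷ʳ y               ∎)))
... | b′ ∷ʳ′ z = inj₁ (a , b′ , ∷ʳ-injectiveˡ (a ++ (s ∷ʳ x) ++ b′) u (begin
  (a ++ (s ∷ʳ x) ++ b′) ∷ʳ z  ≡⟨ ++-assoc a ((s ∷ʳ x) ++ b′) (z ∷ []) ⟩
  a ++ ((s ∷ʳ x) ++ b′) ∷ʳ z  ≡⟨ cong (a ++_) (++-assoc (s ∷ʳ x) b′ (z ∷ [])) ⟩
  a ++ (s ∷ʳ x) ++ b′ ∷ʳ z    ≡⟨ e ⟩
  u ∷ʳ y                      ∎))

r-prefix-closed : ∀ S u v → r S (u ++ v) → r S u
r-prefix-closed S u v = All.map (λ s⋢uv s⊑u → s⋢uv (⊑-++ʳ v s⊑u))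

¬r-suffix : ∀ {S s} → s ∈ S → ∀ w → ¬ r S (w ++ s)
¬r-suffix s∈S w rw = All.lookup rw s∈S (⊑-suffix w _)

-- The number of 1s after the last 0 of a string, counting from `start` if it has no 0.
trailingOnes : ℕ → BinStr → ℕ
trailingOnes = foldl count
  where
  count : ℕ → Bool → ℕ
  count m true  = suc m
  count m false = 0

trailingOnes-∷ʳ-true : ∀ start u → trailingOnes start (u ∷ʳ true) ≡ suc (trailingOnes start u)
trailingOnes-∷ʳ-true start u = foldl-∷ʳ _ start true u

trailingOnes-∷ʳ-false : ∀ start u → trailingOnes start (u ∷ʳ false) ≡ 0
trailingOnes-∷ʳ-false start u = foldl-∷ʳ _ start false u

trailingOnes-ones : ∀ start m → trailingOnes start (ones m) ≡ m + start
trailingOnes-ones start zero    = refl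
trailingOnes-ones start (suc m) = trans (trailingOnes-ones (suc start) m) (+-suc m start)

trailingOnes-endsWith : ∀ start {u} m → u EndsWith (false ∷ ones m) → trailingOnes start u ≡ m
trailingOnes-endsWith start m (w , refl) = begin
  trailingOnes start (w ++ false ∷ ones m) ≡⟨ foldl-++ _ start w (false ∷ ones m) ⟩
  trailingOnes 0 (ones m)                  ≡⟨ trailingOnes-ones 0 m ⟩
  m + 0                                    ≡⟨ +-identityʳ m ⟩
  m                                        ∎

block-free-∷ʳ-true : ∀ {m u} → ¬ block m ⊑ u → ¬ block m ⊑ (u ∷ʳ true)
block-free-∷ʳ-true {m} {u} free b⊑ with ⊑-∷ʳ⁻ (false ∷ ones m) u b⊑
... | inj₁ b⊑u     = free b⊑u
... | inj₂ (_ , ())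

block-free-∷ʳ-false : ∀ start {m u} → trailingOnes start u ≢ m →
                      ¬ block m ⊑ u → ¬ block m ⊑ (u ∷ʳ false)
block-free-∷ʳ-false start {m} {u} t≢m free b⊑ with ⊑-∷ʳ⁻ (false ∷ ones m) u b⊑
... | inj₁ b⊑u        = free b⊑u
... | inj₂ (ends , _) = t≢m (trailingOnes-endsWith start m ends)

-- Games against two candidates

-- step p Q b y is p y ∷ʳ lie (Q y) b by definition.
lie : Bool → Bool → Bool
lie c b = if does (c ≟ b) then false else true

lie-false : ∀ b → lie false b ≡ not (lie true b)
lie-false true  = refl
lie-false false = refl

module ObscurerInvariant {R : BinStr → Set} (Inv : BinStr → BinStr → Set)
  (alive    : ∀ {u v} → Inv u v → R u × R v)
  (lie-both : ∀ {u v} → Inv u v → Inv (u ∷ʳ true) (v ∷ʳ true))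
  (lie-once : ∀ {u v} → Inv u v → Inv (u ∷ʳ false) (v ∷ʳ true) ⊎ Inv (u ∷ʳ true) (v ∷ʳ false))
  where

  private
    answer : ∀ {u v} c d → Inv u v → ∃ λ b → Inv (u ∷ʳ lie c b) (v ∷ʳ lie d b)
    answer true  true  inv = false , lie-both inv
    answer false false inv = true  , lie-both inv
    answer true  false inv = Sum.[ (true ,_) , (false ,_) ] (lie-once inv)
    answer false true  inv = Sum.[ (false ,_) , (true ,_) ] (lie-once inv)

  ¬seekerWinsFrom : ∀ {p : Position 2} → Inv (p 0F) (p 1F) → ¬ SeekerWinsFrom R p
  ¬seekerWinsFrom inv (done atMostOne) =
    0≢1+n (atMostOne 0F 1F (proj₁ (alive inv)) (proj₂ (alive inv)))
  ¬seekerWinsFrom inv (ask Q next) with b , inv′ ← answer (Q 0F) (Q 1F) inv =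
    ¬seekerWinsFrom inv′ (next b)

  ¬seekerWins : Inv [] [] → ¬ SeekerWins R
  ¬seekerWins inv seekerWins = ¬seekerWinsFrom inv (seekerWins 2 (s≤s z≤n))

data Kills (R : BinStr → Set) (u v : BinStr) : Set where
  dead  : ¬ R u ⊎ ¬ R v → Kills R u v
  same  : (∀ b → Kills R (u ∷ʳ b) (v ∷ʳ b)) → Kills R u v
  split : (∀ b → Kills R (u ∷ʳ b) (v ∷ʳ not b)) → Kills R u v

Kills-sym : ∀ {R u v} → Kills R u v → Kills R v u
Kills-sym (dead d)  = dead (Sum.swap d)
Kills-sym (same k)  = same λ b → Kills-sym (k b)
Kills-sym {R} {u} {v} (split k) = split λ b →
  subst (λ c → Kills R (v ∷ʳ c) (u ∷ʳ not b)) (not-involutive b) (Kills-sym (k (not b)))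

_≼_ : ∀ {n} → Position n → Position n → Set
p ≼ p′ = ∀ y → ∃ λ v → p y ++ v ≡ p′ y

≼-refl : ∀ {n} (p : Position n) → p ≼ p
≼-refl p y = [] , ++-identityʳ (p y)

≼-step : ∀ {n} (p : Position n) Q b → p ≼ step p Q b
≼-step p Q b y = _ , refl

≼-trans : ∀ {n} {p p′ p″ : Position n} → p ≼ p′ → p′ ≼ p″ → p ≼ p″
≼-trans {p = p} {p′} {p″} p≼p′ p′≼p″ y with v , e ← p≼p′ y | v′ , e′ ← p′≼p″ y =
  v ++ v′ , (begin
    p y ++ v ++ v′   ≡⟨ ++-assoc (p y) v v′ ⟨
    (p y ++ v) ++ v′ ≡⟨ cong (_++ v′) e ⟩
    p′ y ++ v′       ≡⟨ e′ ⟩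
    p″ y             ∎)

module PlayKills {R : BinStr → Set} {n} {X Y : Fin n} (X≢Y : X ≢ Y) where

  AfterKill : Position n → Set
  AfterKill p = ∀ {p′} → p ≼ p′ → ¬ R (p′ X) ⊎ ¬ R (p′ Y) → SeekerWinsFrom R p′

  private
    everyone : Fin n → Bool
    everyone _ = true

    separate : Fin n → Bool
    separate y = does (y ≟ᶠ X)

    separate-X : separate X ≡ true
    separate-X = dec-true (X ≟ᶠ X) refl

    separate-Y : separate Y ≡ false
    separate-Y = dec-false (Y ≟ᶠ X) (X≢Y ∘ sym)

    step-separate : ∀ p y {c} b → separate y ≡ c → step p separate b y ≡ p y ∷ʳ lie c b
    step-separate p y b e = cong (λ c → p y ∷ʳ lie c b) e

    afterKill-step : ∀ {p} Q b → AfterKill p → AfterKill (step p Q b)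
    afterKill-step {p} Q b K p≼p′ = K (≼-trans (≼-step p Q b) p≼p′)

  kills-then : ∀ {u v} → Kills R u v →
               ∀ {p} → p X ≡ u → p Y ≡ v → AfterKill p → SeekerWinsFrom R p
  kills-then (dead d)  {p} refl refl K = K (≼-refl p) d
  kills-then (same k)  {p} refl refl K = ask everyone λ b →
    kills-then (k (lie true b)) {step p everyone b} refl refl (afterKill-step everyone b K)
  kills-then (split k) {p} refl refl K = ask separate λ b →
    kills-then (k (lie true b)) {step p separate b}
      (step-separate p X b separate-X)
      (trans (step-separate p Y b separate-Y) (cong (p Y ∷ʳ_) (lie-false b)))
      (afterKill-step separate b K)

module EliminationByPairs {R : BinStr → Set} (prefix-closed : ∀ u v → R (u ++ v) → R u)
                          (kills : ∀ u v → Kills R u v) where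

  alive-≼ : ∀ {n} {p p′ : Position n} → p ≼ p′ → ∀ y → R (p′ y) → R (p y)
  alive-≼ {p = p} p≼p′ y alive with v , e ← p≼p′ y = prefix-closed (p y) v (subst R (sym e) alive)

  eliminate : ∀ {n} (x : Fin n) ys p → (∀ y → R (p y) → y ∈ x ∷ ys) → SeekerWinsFrom R p
  eliminate x [] p survivors = done λ y z ry rz →
    trans (singleton⁻ (survivors y ry)) (sym (singleton⁻ (survivors z rz)))
  eliminate x (z ∷ ys) p survivors with x ≟ᶠ z
  ... | yes refl = eliminate x ys p λ y ry → drop-duplicate (survivors y ry)
    where
    drop-duplicate : ∀ {y} → y ∈ x ∷ x ∷ ys → y ∈ x ∷ ys
    drop-duplicate (here e)  = here e
    drop-duplicate (there m) = m
  ... | no x≢z = PlayKills.kills-then x≢z (kills (p x) (p z)) refl refl continue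
    where
    drop-x : ∀ {y} → y ∈ x ∷ z ∷ ys → y ≢ x → y ∈ z ∷ ys
    drop-x (here y≡x) y≢x = contradiction y≡x y≢x
    drop-x (there m)  _   = m

    drop-z : ∀ {y} → y ∈ x ∷ z ∷ ys → y ≢ z → y ∈ x ∷ ys
    drop-z (here e)            _   = here e
    drop-z (there (here y≡z))  y≢z = contradiction y≡z y≢z
    drop-z (there (there m))   _   = there m

    continue : PlayKills.AfterKill {R} x≢z p
    continue p≼p′ (inj₁ x-dead) = eliminate z ys _ λ y ry →
      drop-x (survivors y (alive-≼ p≼p′ y ry)) λ { refl → x-dead ry }
    continue p≼p′ (inj₂ z-dead) = eliminate x ys _ λ y ry →
      drop-z (survivors y (alive-≼ p≼p′ y ry)) λ { refl → z-dead ry }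

  seekerWins : SeekerWins R
  seekerWins zero    ()
  seekerWins (suc n) _ = eliminate 0F _ (λ _ → []) λ y _ → ∈-allFin y

-- The Obscurer's strategy

module Obscurer (k : ℕ) (k≢1 : k ≢ 1) where

  Avoids : BinStr → Set
  Avoids u = ¬ block 0 ⊑ u × ¬ block k ⊑ u

  -- Starting the count at k + 1 puts patterns without a 0 beyond every run that matters.
  run : BinStr → ℕ
  run = trailingOnes (suc k)

  -- Equal runs occur only while neither pattern contains a 0, and then both exceed k.
  Good : ℕ → ℕ → Set
  Good a b = (a ≡ b → k < a) × ¬ (a ≡ 0 × b ≡ k) × ¬ (b ≡ 0 × a ≡ k)

  Good-sym : ∀ {a b} → Good a b → Good b a
  Good-sym (a≡b⇒k<a , ¬0k , ¬k0) =
    (λ b≡a → subst (k <_) (sym b≡a) (a≡b⇒k<a (sym b≡a))) , ¬k0 , ¬0k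

  Good-suc : ∀ {a b} → Good a b → Good (suc a) (suc b)
  Good-suc (a≡b⇒k<a , _ , _) =
    m<n⇒m<1+n ∘ a≡b⇒k<a ∘ suc-injective , (λ { (() , _) }) , (λ { (() , _) })

  MayTakeZero : ℕ → ℕ → Set
  MayTakeZero a b = a ≢ 0 × a ≢ k × suc b ≢ k

  Good-take-zero : ∀ {a b} → MayTakeZero a b → Good 0 (suc b)
  Good-take-zero (_ , _ , 1+b≢k) = (λ ()) , (λ { (_ , 1+b≡k) → 1+b≢k 1+b≡k }) , (λ { (() , _) })

  Good-separable : ∀ {a b} → Good a b → MayTakeZero a b ⊎ MayTakeZero b a
  Good-separable {a} {b} (a≡b⇒k<a , ¬0k , ¬k0) with a ≟ⁿ 0 | a ≟ⁿ k | suc b ≟ⁿ k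
  ... | no a≢0 | no a≢k | no 1+b≢k = inj₁ (a≢0 , a≢k , 1+b≢k)
  ... | yes refl | _ | _ =
    inj₂ ((λ b≡0 → n≮0 (a≡b⇒k<a (sym b≡0))) , (λ b≡k → ¬0k (refl , b≡k)) , k≢1 ∘ sym)
  ... | no _ | yes refl | _ =
    inj₂ ((λ b≡0 → ¬k0 (b≡0 , refl)) , (λ { refl → <⇒≢ (a≡b⇒k<a refl) refl }) , 1+n≢n)
  ... | no _ | no _ | yes refl =
    inj₂ ((λ { refl → k≢1 refl }) , 1+n≢n ∘ sym ,
          (λ 1+a≡1+b → <-asym (a≡b⇒k<a (suc-injective 1+a≡1+b)) (≤-reflexive 1+a≡1+b)))

  Inv : BinStr → BinStr → Set
  Inv u v = Avoids u × Avoids v × Good (run u) (run v)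

  Inv-[] : Inv [] []
  Inv-[] = (¬∷⊑[] , ¬∷⊑[]) , (¬∷⊑[] , ¬∷⊑[]) , (λ _ → n<1+n k) , (λ { (() , _) }) , (λ { (() , _) })

  Inv-sym : ∀ {u v} → Inv u v → Inv v u
  Inv-sym (avoids-u , avoids-v , good) = avoids-v , avoids-u , Good-sym good

  Avoids-∷ʳ-true : ∀ {u} → Avoids u → Avoids (u ∷ʳ true)
  Avoids-∷ʳ-true = Product.map (block-free-∷ʳ-true {0}) (block-free-∷ʳ-true {k})

  Inv-lie-both : ∀ {u v} → Inv u v → Inv (u ∷ʳ true) (v ∷ʳ true)
  Inv-lie-both {u} {v} (avoids-u , avoids-v , good) =
    Avoids-∷ʳ-true avoids-u , Avoids-∷ʳ-true avoids-v ,
    subst₂ Good (sym (trailingOnes-∷ʳ-true (suc k) u)) (sym (trailingOnes-∷ʳ-true (suc k) v))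
      (Good-suc good)

  Inv-take-zero : ∀ {u v} → Inv u v → MayTakeZero (run u) (run v) → Inv (u ∷ʳ false) (v ∷ʳ true)
  Inv-take-zero {u} {v} ((free₀ , freeₖ) , avoids-v , _) may@(run≢0 , run≢k , _) =
    (block-free-∷ʳ-false (suc k) run≢0 free₀ , block-free-∷ʳ-false (suc k) run≢k freeₖ) ,
    Avoids-∷ʳ-true avoids-v ,
    subst₂ Good (sym (trailingOnes-∷ʳ-false (suc k) u)) (sym (trailingOnes-∷ʳ-true (suc k) v))
      (Good-take-zero may)

  Inv-lie-once : ∀ {u v} → Inv u v → Inv (u ∷ʳ false) (v ∷ʳ true) ⊎ Inv (u ∷ʳ true) (v ∷ʳ false)
  Inv-lie-once inv with Good-separable (proj₂ (proj₂ inv))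
  ... | inj₁ may = inj₁ (Inv-take-zero inv may)
  ... | inj₂ may = inj₂ (Inv-sym (Inv-take-zero (Inv-sym inv) may))

  Inv-alive : ∀ {s₂} → block k ⊑ s₂ →
              ∀ {u v} → Inv u v → r (block 0 ∷ s₂ ∷ []) u × r (block 0 ∷ s₂ ∷ []) v
  Inv-alive bk⊑s₂ (avoids-u , avoids-v , _) = alive avoids-u , alive avoids-v
    where
    alive : ∀ {u} → Avoids u → r _ u
    alive (free₀ , freeₖ) = free₀ ∷ (freeₖ ∘ ⊑-trans bk⊑s₂) ∷ []

R#-necessary : ∀ s₂ → SeekerWins (r (block 0 ∷ s₂ ∷ [])) → R# s₂
R#-necessary s₂ seekerWins k k≢1 bk⊑s₂ =
  ¬seekerWins (Inv-alive bk⊑s₂) Inv-lie-both Inv-lie-once Inv-[] seekerWins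
  where
  open Obscurer k k≢1
  open ObscurerInvariant Inv

-- The shape of strings in R#

alternating : ℕ → BinStr
alternating zero    = []
alternating (suc j) = true ∷ false ∷ alternating j

∷ʳ-alternating : ∀ w j → (w ∷ʳ true ∷ʳ false) ++ alternating j ≡ w ++ alternating (suc j)
∷ʳ-alternating w j = trans (∷ʳ-++ (w ∷ʳ true) false (alternating j)) (∷ʳ-++ w true (false ∷ alternating j))

-- The paper's 1^a w 1^c, with 1^a 1^c merged when w is empty and (01)^j 0 written 0 (10)^j.
data R#Shape : BinStr → Set where
  ones⁺  : ∀ a → R#Shape (ones a)
  zigzag : ∀ a j c → R#Shape (ones a ++ false ∷ alternating j ++ ones c)

ones-∷ : ∀ m s → ones m ++ true ∷ s ≡ ones (suc m) ++ s
ones-∷ zero    s = refl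
ones-∷ (suc m) s = cong (true ∷_) (ones-∷ m s)

R#-tail : ∀ {x s} → R# (x ∷ s) → R# s
R#-tail h k k≢1 = h k k≢1 ∘ ⊑-∷ _

R#-after-011 : ∀ m s → R# (false ∷ ones (2 + m) ++ s) → ∃ λ c → s ≡ ones c
R#-after-011 m []          _ = 0 , refl
R#-after-011 m (true ∷ s)  h =
  Product.map suc (cong (true ∷_))
    (R#-after-011 (suc m) s (subst (λ t → R# (false ∷ t)) (ones-∷ (2 + m) s) h))
R#-after-011 m (false ∷ s) h =
  contradiction ([] , s , cong (false ∷_) (++-assoc (ones (2 + m)) (false ∷ []) s)) (h (2 + m) λ ())

R#-after-0 : ∀ s → R# (false ∷ s) → ∃₂ λ j c → s ≡ alternating j ++ ones c
R#-after-0 []                 _ = 0 , 0 , refl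
R#-after-0 (false ∷ s)        h = contradiction ([] , s , refl) (h 0 λ ())
R#-after-0 (true ∷ [])        _ = 0 , 1 , refl
R#-after-0 (true ∷ false ∷ s) h with j , c , e ← R#-after-0 s (R#-tail (R#-tail h)) =
  suc j , c , cong (λ t → true ∷ false ∷ t) e
R#-after-0 (true ∷ true ∷ s)  h with c , e ← R#-after-011 0 s h =
  0 , 2 + c , cong (λ t → true ∷ true ∷ t) e

R#⇒R#Shape : ∀ s → R# s → R#Shape s
R#⇒R#Shape []          _ = ones⁺ 0
R#⇒R#Shape (true ∷ s)  h with R#⇒R#Shape s (R#-tail h)
... | ones⁺ a        = ones⁺ (suc a)
... | zigzag a j c   = zigzag (suc a) j c
R#⇒R#Shape (false ∷ s) h with j , c , refl ← R#-after-0 s h = zigzag 0 j c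

-- The Seeker's strategy

module Seeker (s₂ : BinStr) where

  R : BinStr → Set
  R = r (block 0 ∷ s₂ ∷ [])

  ¬R-00 : ∀ w → ¬ R (w ∷ʳ false ∷ʳ false)
  ¬R-00 w = subst (¬_ ∘ R) (sym (++-assoc w (false ∷ []) (false ∷ []))) (¬r-suffix (here refl) w)

  ¬R-s₂ : ∀ w → ¬ R (w ++ s₂)
  ¬R-s₂ = ¬r-suffix (there (here refl))

  kills-after-zeros : ∀ u v → Kills R (u ∷ʳ false) (v ∷ʳ false)
  kills-after-zeros u v = split λ where
    false → dead (inj₁ (¬R-00 u))
    true  → dead (inj₂ (¬R-00 v))

  kills-pad-ones : ∀ m u v → Kills R (u ++ ones m) (v ++ ones m) → Kills R u v
  kills-pad-ones zero    u v K = subst₂ (Kills R) (++-identityʳ u) (++-identityʳ v) K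
  kills-pad-ones (suc m) u v K = same λ where
    false → kills-after-zeros u v
    true  → kills-pad-ones m (u ∷ʳ true) (v ∷ʳ true)
              (subst₂ (Kills R) (sym (∷ʳ-++ u true (ones m))) (sym (∷ʳ-++ v true (ones m))) K)

  kills-pad-alternating : ∀ j w → (∀ v → Kills R ((w ∷ʳ false) ++ alternating j) v) →
                          ∀ v → Kills R (w ∷ʳ false) v
  kills-pad-alternating zero    w K v = subst (λ u → Kills R u v) (++-identityʳ (w ∷ʳ false)) (K v)
  kills-pad-alternating (suc j) w K v = split λ where
    false → dead (inj₁ (¬R-00 w))
    true  → split λ where
      true  → dead (inj₂ (¬R-00 v))
      false → kills-pad-alternating j (w ∷ʳ false ∷ʳ true)
                (λ v′ → subst (λ u → Kills R u v′) (sym (∷ʳ-alternating (w ∷ʳ false) j)) (K v′))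
                (v ∷ʳ false ∷ʳ true)

  ends-with-zigzag : ∀ u a j c →
    (((u ++ ones a) ∷ʳ false) ++ alternating j) ++ ones c ≡ u ++ ones a ++ false ∷ alternating j ++ ones c
  ends-with-zigzag u a j c = begin
    (((u ++ ones a) ∷ʳ false) ++ alternating j) ++ ones c ≡⟨ ++-assoc ((u ++ ones a) ∷ʳ false) _ _ ⟩
    ((u ++ ones a) ∷ʳ false) ++ alternating j ++ ones c   ≡⟨ ∷ʳ-++ (u ++ ones a) false _ ⟩
    (u ++ ones a) ++ false ∷ alternating j ++ ones c      ≡⟨ ++-assoc u (ones a) _ ⟩
    u ++ ones a ++ false ∷ alternating j ++ ones c        ∎

  kills : R#Shape s₂ → ∀ u v → Kills R u v
  kills (ones⁺ a) u v = kills-pad-ones a u v (dead (inj₁ (¬R-s₂ u)))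
  kills (zigzag a j c) u v = kills-pad-ones a u v (split λ where
      false → finish u ((v ++ ones a) ∷ʳ true)
      true  → Kills-sym (finish v ((u ++ ones a) ∷ʳ true)))
    where
    finish : ∀ u v → Kills R ((u ++ ones a) ∷ʳ false) v
    finish u = kills-pad-alternating j (u ++ ones a) λ v → kills-pad-ones c _ v
      (dead (inj₁ (subst (¬_ ∘ R) (sym (ends-with-zigzag u a j c)) (¬R-s₂ u))))

-- The equivalence holds without the hypotheses on s₂.
lemma9 : ∀ (s₂ : BinStr) → 2 ≤ length s₂ → s₂ ≢ false ∷ false ∷ [] →
    (SeekerWins (r ((false ∷ false ∷ []) ∷ s₂ ∷ [])) ⇔ R# s₂)
lemma9 s₂ _ _ = mk⇔ (R#-necessary s₂) λ s₂∈R# →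
  EliminationByPairs.seekerWins (r-prefix-closed _) (Seeker.kills s₂ (R#⇒R#Shape s₂ s₂∈R#))
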